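{- Let $n\ge1$, let $\mathcal B$ be a bumpless pipe dream of size $n$, and fix $k\in[n-1]$. If $\delta(\mathcal B)$ has an ascent at $k$, then $\delta(\check{\mathcal B})$ also has an ascent at $k$. In other words, $\mathrm{des}(\delta(\check{\mathcal B}))\subseteq\mathrm{des}(\delta(\mathcal B))$.
   Context: $v\in S_n$ has an ascent at $k$ if $v(k)<v(k+1)$ and a descent if $v(k)>v(k+1)$; $\mathrm{des}(v)$ is its descent set. A bumpless pipe dream (BPD) of size $n$ is a tiling of the $n\times n$ grid (row 1 on top) by six tiles — elbow joining bottom and right edges, elbow joining top and left edges, horizontal, vertical, crossing, blank — whose segments form $n$ pipes, each entering through the bottom edge of a column and leaving through the right edge of a row (pipes travel north/east; not necessarily reduced). Label pipes $1,\dots,n$ by entry column; at a crossing the larger incoming label (from below/left) exits through the top and the smaller through the right; $\delta(\mathcal B)(r)$ is the label leaving the right edge of row $r$. A co-BPD of size $n$ is a tiling of the $n\times n$ grid by six tiles — elbow joining top and right edges, elbow joining bottom and left edges, crossing, blank, horizontal, vertical — forming $n$ pipes each entering through the top edge of a column and leaving through the right edge of a row. Label pipes by entry column; at a crossing the larger incoming label (from above/left) exits at the bottom, the smaller on the right; $\delta$ of a co-BPD is the sequence of labels on the right edge, top to bottom. $\check{\mathcal B}$ is obtained from $\mathcal B$ tile by tile: bottom–right elbow $\mapsto$ top–right elbow; top–left elbow $\mapsto$ bottom–left elbow; horizontal $\mapsto$ crossing; vertical $\mapsto$ blank; crossing $\mapsto$ horizontal; blank $\mapsto$ vertical. -}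

module Defs where

open import Data.Nat using (ℕ; zero; suc; _<_; _⊔_; _⊓_)
open import Data.Bool using (Bool; true; false)
open import Data.Fin using (Fin; toℕ)
open import Data.Vec using (Vec; []; _∷_; lookup; map; toList)
open import Data.List using (List; []; _∷_)
open import Data.Product using (_×_; _,_)
open import Data.Empty using (⊥)
open import Relation.Binary.PropositionalEquality using (_≡_)

-- Bumpless pipe dream tiles (pipes travel north/east)

data Tile : Set where
  elbowSE  : Tile
  elbowNW  : Tile
  horiz    : Tile
  vert     : Tile
  cross    : Tile
  blank    : Tile

-- which edges of a tile carry a pipe segment
tN tE tS tW : Tile → Bool
tN elbowNW = true
tN vert    = true
tN cross   = true
tN _       = false
tE elbowSE = true
tE horiz   = true
tE cross   = true
tE _       = false
tS elbowSE = true
tS vert    = true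
tS cross   = true
tS _       = false
tW elbowNW = true
tW horiz   = true
tW cross   = true
tW _       = false

-- an n × n grid; row index zero is the top row, column zero is the leftmost
Grid : Set → ℕ → Set
Grid A n = Vec (Vec A n) n

cell : ∀ {A n} → Grid A n → Fin n → Fin n → A
cell G r c = lookup (lookup G r) c

record IsBPD {n : ℕ} (G : Grid Tile n) : Set where
  field
    horizMatch : ∀ r (c c' : Fin n) → toℕ c' ≡ suc (toℕ c) →
                 tE (cell G r c) ≡ tW (cell G r c')
    vertMatch  : ∀ (r r' : Fin n) c → toℕ r' ≡ suc (toℕ r) →
                 tS (cell G r c) ≡ tN (cell G r' c)
    topEmpty   : ∀ (r c : Fin n) → toℕ r ≡ 0 → tN (cell G r c) ≡ false
    leftEmpty  : ∀ (r c : Fin n) → toℕ c ≡ 0 → tW (cell G r c) ≡ false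
    bottomIn   : ∀ (r c : Fin n) → suc (toℕ r) ≡ n → tS (cell G r c) ≡ true
    rightOut   : ∀ (r c : Fin n) → suc (toℕ c) ≡ n → tE (cell G r c) ≡ true

-- Label propagation in a BPD.  Pipes are labelled 1..n by entry column;
-- the value 0 stands for "no pipe" (never occurs on a pipe edge of a BPD).

-- given (label from below, label from left) return (label out top, label out right)
stepBPD : Tile → ℕ → ℕ → ℕ × ℕ
stepBPD elbowSE s w = 0 , s
stepBPD elbowNW s w = w , 0
stepBPD horiz   s w = 0 , w
stepBPD vert    s w = s , 0
stepBPD cross   s w = (s ⊔ w) , (s ⊓ w)
stepBPD blank   s w = 0 , 0

-- process one row left to right: labels from below, label from left
-- ↦ labels out of the top, label out of the right edge
rowBPD : ∀ {k} → Vec Tile k → Vec ℕ k → ℕ → Vec ℕ k × ℕ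
rowBPD []       []       w = [] , w
rowBPD (t ∷ ts) (s ∷ ss) w with stepBPD t s w
... | (up , right) with rowBPD ts ss right
...   | (ups , out) = (up ∷ ups) , out

-- process rows (listed top to bottom) starting from labels entering at the
-- bottom; returns labels on the top edge and right-edge labels top to bottom
rowsBPD : ∀ {k m} → Vec (Vec Tile k) m → Vec ℕ k → Vec ℕ k × Vec ℕ m
rowsBPD []           b = b , []
rowsBPD (row ∷ rows) b with rowsBPD rows b
... | (mid , exs) with rowBPD row mid 0
...   | (top , e) = top , (e ∷ exs)

labels : (n : ℕ) → Vec ℕ n
labels n = map (λ i → suc (toℕ i)) (Data.Vec.allFin n)
  where import Data.Vec

δ : ∀ {n} → Grid Tile n → Vec ℕ n
δ {n} G with rowsBPD G (labels n)
... | (_ , exs) = exs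

-- co-BPD tiles (pipes travel south/east)

data CoTile : Set where
  celbowNE : CoTile
  celbowSW : CoTile
  ccross   : CoTile
  cblank   : CoTile
  choriz   : CoTile
  cvert    : CoTile

-- given (label from above, label from left) return (label out bottom, label out right)
stepCo : CoTile → ℕ → ℕ → ℕ × ℕ
stepCo celbowNE n' w = 0 , n'
stepCo celbowSW n' w = w , 0
stepCo ccross   n' w = (n' ⊔ w) , (n' ⊓ w)
stepCo cblank   n' w = 0 , 0
stepCo choriz   n' w = 0 , w
stepCo cvert    n' w = n' , 0

rowCo : ∀ {k} → Vec CoTile k → Vec ℕ k → ℕ → Vec ℕ k × ℕ
rowCo []       []       w = [] , w
rowCo (t ∷ ts) (a ∷ as) w with stepCo t a w
... | (down , right) with rowCo ts as right
...   | (downs , out) = (down ∷ downs) , out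

rowsCo : ∀ {k m} → Vec (Vec CoTile k) m → Vec ℕ k → Vec ℕ m
rowsCo []           t = []
rowsCo (row ∷ rows) t with rowCo row t 0
... | (bot , e) = e ∷ rowsCo rows bot

δco : ∀ {n} → Grid CoTile n → Vec ℕ n
δco {n} G = rowsCo G (labels n)

checkTile : Tile → CoTile
checkTile elbowSE = celbowNE
checkTile elbowNW = celbowSW
checkTile horiz   = ccross
checkTile vert    = cblank
checkTile cross   = choriz
checkTile blank   = cvert

check : ∀ {n} → Grid Tile n → Grid CoTile n
check G = map (map checkTile) G

-- ascent at position k (0-indexed: compares entries k and k+1)

AscentAt : List ℕ → ℕ → Set
AscentAt (a ∷ b ∷ _) zero    = a < b
AscentAt (_ ∷ xs)    (suc k) = AscentAt xs k
AscentAt _           _       = ⊥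

HasAscent : ∀ {n} → Vec ℕ n → ℕ → Set
HasAscent v k = AscentAt (toList v) k

module Submission where

open import Defs
open import Data.Nat using (ℕ; zero; suc; _+_; _<_; _≤_; _≟_; z≤n; s≤s; z<s)
open import Data.Nat.Properties
open import Algebra.Properties.CommutativeSemigroup +-commutativeSemigroup using (x∙yz≈y∙xz)
open import Data.Bool using (Bool; true; false; not; if_then_else_; T)
open import Data.Fin using (Fin; toℕ) renaming (zero to fzero; suc to fsuc)
open import Data.Fin.Properties using (toℕ-injective)
open import Data.Vec using (Vec; []; _∷_; lookup; map; sum; toList; allFin)
open import Data.Vec.Relation.Unary.All as All using (All; []; _∷_)
open import Data.Vec.Relation.Unary.All.Properties using (map⁺)
open import Data.Vec.Relation.Unary.Unique.Propositional using (Unique)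
open import Data.Vec.Relation.Unary.Unique.Propositional.Properties as Unique using (tabulate⁺)
open import Data.Vec.Relation.Unary.AllPairs using ([]; _∷_)
open import Data.Vec.Relation.Binary.Pointwise.Inductive as Pointwise
  using (Pointwise; []; _∷_; All⇒Pointwiseʳ)
open import Data.Vec.Relation.Binary.Pointwise.Extensional using (ext; extensional⇒inductive)
open import Data.Product using (_×_; _,_; proj₁; proj₂)
open import Data.Sum using (_⊎_; inj₁; inj₂)
open import Data.Unit using (⊤; tt)
open import Relation.Binary.PropositionalEquality
open import Relation.Nullary using (does; yes; no; contradiction)
open import Function using (_∘_)
open import Relation.Nullary.Decidable using (dec-true; dec-false)

-- Compare rows k and k+1 column by column, remembering which of the two
-- contains the most recent bottom–right elbow.  While both rows carry a
-- horizontal pipe, the row holding that elbow carries the larger label, in B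
-- as well as in B̌.  So at the right boundary either δ(B)(k) ≥ δ(B)(k+1) or
-- δ(B̌)(k) ≤ δ(B̌)(k+1).  In the second case the inequality is strict: no
-- co-BPD tile duplicates a label, so each label 1..n leaves B̌ at most once,
-- and the label leaving row k is positive.

ConnectedRow : ∀ {m} → Bool → Vec Tile m → Set
ConnectedRow h []       = h ≡ true
ConnectedRow h (t ∷ ts) = tW t ≡ h × ConnectedRow (tE t) ts

VerticallyMatched : ∀ {m} → Vec Tile m → Vec Tile m → Set
VerticallyMatched = Pointwise (λ t₀ t₁ → tS t₀ ≡ tN t₁)

WellFormedRows : ∀ {n m} → Vec (Vec Tile n) m → Set
WellFormedRows []            = ⊤
WellFormedRows (R ∷ [])      = ConnectedRow false R
WellFormedRows (R₀ ∷ R₁ ∷ Rs) =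
  ConnectedRow false R₀ × VerticallyMatched R₀ R₁ × WellFormedRows (R₁ ∷ Rs)

wellFormedRows-head : ∀ {n m} {R : Vec Tile n} (Rs : Vec (Vec Tile n) m) →
  WellFormedRows (R ∷ Rs) → ConnectedRow false R
wellFormedRows-head []      c       = c
wellFormedRows-head (_ ∷ _) (c , _) = c

connectedRow : ∀ {m} h (R : Vec Tile (suc m)) → tW (lookup R fzero) ≡ h →
  (∀ (c c' : Fin (suc m)) → toℕ c' ≡ suc (toℕ c) → tE (lookup R c) ≡ tW (lookup R c')) →
  (∀ c → suc (toℕ c) ≡ suc m → tE (lookup R c) ≡ true) →
  ConnectedRow h R
connectedRow h (t ∷ [])      refl match last = refl , last fzero refl
connectedRow h (t ∷ t' ∷ ts) refl match last =
  refl , connectedRow (tE t) (t' ∷ ts) (sym (match fzero (fsuc fzero) refl))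
           (λ c c' eq → match (fsuc c) (fsuc c') (cong suc eq))
           (λ c eq → last (fsuc c) (cong suc eq))

wellFormedRows : ∀ {n m} (G : Vec (Vec Tile n) m) →
  (∀ r → ConnectedRow false (lookup G r)) →
  (∀ (r r' : Fin m) → toℕ r' ≡ suc (toℕ r) → VerticallyMatched (lookup G r) (lookup G r')) →
  WellFormedRows G
wellFormedRows []            _         _       = tt
wellFormedRows (R ∷ [])      connected _       = connected fzero
wellFormedRows (R ∷ R' ∷ Rs) connected matched =
  connected fzero , matched fzero (fsuc fzero) refl ,
  wellFormedRows (R' ∷ Rs) (λ r → connected (fsuc r))
    (λ r r' eq → matched (fsuc r) (fsuc r') (cong suc eq))

isBPD⇒wellFormedRows : ∀ {n} {G : Grid Tile (suc n)} → IsBPD G → WellFormedRows G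
isBPD⇒wellFormedRows {G = G} bpd = wellFormedRows G
  (λ r → connectedRow false (lookup G r) (leftEmpty r fzero refl) (horizMatch r) (rightOut r))
  (λ r r' eq → extensional⇒inductive (ext (λ c → vertMatch r r' c eq)))
  where open IsBPD bpd

updateLastElbowInUpper : Tile → Tile → Bool → Bool
updateLastElbowInUpper elbowSE _       _ = true
updateLastElbowInUpper _       elbowSE _ = false
updateLastElbowInUpper _       _       u = u

lastElbowInUpper : ∀ {m} → Bool → Vec Tile m → Vec Tile m → Bool
lastElbowInUpper u []         []         = u
lastElbowInUpper u (t₀ ∷ R₀) (t₁ ∷ R₁) = lastElbowInUpper (updateLastElbowInUpper t₀ t₁ u) R₀ R₁

OrderedIf : Bool → Bool → Bool → ℕ → ℕ → Set
OrderedIf h₀ h₁ g m n = T h₀ → T h₁ → T g → m ≤ n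

stepBPD-exit-ordered : ∀ t₀ t₁ x w₀ w₁ u → tS t₀ ≡ tN t₁ →
  OrderedIf (tW t₀) (tW t₁) u w₁ w₀ →
  OrderedIf (tE t₀) (tE t₁) (updateLastElbowInUpper t₀ t₁ u)
    (proj₂ (stepBPD t₁ x w₁)) (proj₂ (stepBPD t₀ (proj₁ (stepBPD t₁ x w₁)) w₀))
stepBPD-exit-ordered elbowNW _       _ _  _  _ _  _   ()
stepBPD-exit-ordered vert    _       _ _  _  _ _  _   ()
stepBPD-exit-ordered blank   _       _ _  _  _ _  _   ()
stepBPD-exit-ordered _       elbowNW _ _  _  _ _  _   _ ()
stepBPD-exit-ordered _       vert    _ _  _  _ _  _   _ ()
stepBPD-exit-ordered _       blank   _ _  _  _ _  _   _ ()
stepBPD-exit-ordered elbowSE elbowSE _ _  _  _ ()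
stepBPD-exit-ordered elbowSE horiz   _ _  _  _ ()
stepBPD-exit-ordered elbowSE cross   x _  w₁ _ _  _   _ _ _ = m⊓n≤m⊔n x w₁
stepBPD-exit-ordered horiz   elbowSE _ _  _  _ _  _   _ _ ()
stepBPD-exit-ordered horiz   horiz   _ _  _  _ _  ord = ord
stepBPD-exit-ordered horiz   cross   _ _  _  _ ()
stepBPD-exit-ordered cross   elbowSE _ _  _  _ _  _   _ _ ()
stepBPD-exit-ordered cross   horiz   _ _  _  _ ()
stepBPD-exit-ordered cross   cross   x _  w₁ _ _  ord e₀ e₁ u =
  ⊓-glb (m⊓n≤m⊔n x w₁) (≤-trans (m⊓n≤n x w₁) (ord e₀ e₁ u))

rowBPD-exit-ordered : ∀ {m h₀ h₁ w₀ w₁} (R₀ R₁ : Vec Tile m) (s : Vec ℕ m) u →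
  ConnectedRow h₀ R₀ → ConnectedRow h₁ R₁ → VerticallyMatched R₀ R₁ →
  OrderedIf h₀ h₁ u w₁ w₀ → lastElbowInUpper u R₀ R₁ ≡ true →
  proj₂ (rowBPD R₁ s w₁) ≤ proj₂ (rowBPD R₀ (proj₁ (rowBPD R₁ s w₁)) w₀)
rowBPD-exit-ordered [] [] [] u refl refl [] ord refl = ord tt tt tt
rowBPD-exit-ordered (t₀ ∷ R₀) (t₁ ∷ R₁) (x ∷ s) u (refl , c₀) (refl , c₁) (v ∷ vs) ord last =
  rowBPD-exit-ordered R₀ R₁ s _ c₀ c₁ vs (stepBPD-exit-ordered t₀ t₁ x _ _ u v ord) last

stepCo-exit-ordered : ∀ t₀ t₁ x w₀ w₁ u → tS t₀ ≡ tN t₁ →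
  OrderedIf (tW t₀) (tW t₁) (not u) w₀ w₁ →
  OrderedIf (tE t₀) (tE t₁) (not (updateLastElbowInUpper t₀ t₁ u))
    (proj₂ (stepCo (checkTile t₀) x w₀))
    (proj₂ (stepCo (checkTile t₁) (proj₁ (stepCo (checkTile t₀) x w₀)) w₁))
stepCo-exit-ordered elbowNW _       _ _  _ _ _  _   ()
stepCo-exit-ordered vert    _       _ _  _ _ _  _   ()
stepCo-exit-ordered blank   _       _ _  _ _ _  _   ()
stepCo-exit-ordered _       elbowNW _ _  _ _ _  _   _ ()
stepCo-exit-ordered _       vert    _ _  _ _ _  _   _ ()
stepCo-exit-ordered _       blank   _ _  _ _ _  _   _ ()
stepCo-exit-ordered elbowSE elbowSE _ _  _ _ ()
stepCo-exit-ordered elbowSE horiz   _ _  _ _ ()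
stepCo-exit-ordered elbowSE cross   _ _  _ _ _  _   _ _ ()
stepCo-exit-ordered horiz   elbowSE x w₀ _ _ _  _   _ _ _ = m⊓n≤m⊔n x w₀
stepCo-exit-ordered horiz   horiz   x w₀ _ _ _  ord e₀ e₁ u =
  ⊓-glb (m⊓n≤m⊔n x w₀) (≤-trans (m⊓n≤n x w₀) (ord e₀ e₁ u))
stepCo-exit-ordered horiz   cross   _ _  _ _ ()
stepCo-exit-ordered cross   elbowSE _ _  _ _ ()
stepCo-exit-ordered cross   horiz   _ _  _ _ ()
stepCo-exit-ordered cross   cross   _ _  _ _ _  ord = ord

rowCo-exit-ordered : ∀ {m h₀ h₁ w₀ w₁} (R₀ R₁ : Vec Tile m) (a : Vec ℕ m) u →
  ConnectedRow h₀ R₀ → ConnectedRow h₁ R₁ → VerticallyMatched R₀ R₁ →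
  OrderedIf h₀ h₁ (not u) w₀ w₁ → lastElbowInUpper u R₀ R₁ ≡ false →
  proj₂ (rowCo (map checkTile R₀) a w₀) ≤
    proj₂ (rowCo (map checkTile R₁) (proj₁ (rowCo (map checkTile R₀) a w₀)) w₁)
rowCo-exit-ordered [] [] [] u refl refl [] ord refl = ord tt tt tt
rowCo-exit-ordered (t₀ ∷ R₀) (t₁ ∷ R₁) (x ∷ a) u (refl , c₀) (refl , c₁) (v ∷ vs) ord last =
  rowCo-exit-ordered R₀ R₁ a _ c₀ c₁ vs (stepCo-exit-ordered t₀ t₁ x _ _ u v ord) last

adjacentRows-exit-dichotomy : ∀ {m} (R₀ R₁ : Vec Tile m) (s a : Vec ℕ m) →
  ConnectedRow false R₀ → ConnectedRow false R₁ → VerticallyMatched R₀ R₁ →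
  proj₂ (rowBPD R₁ s 0) ≤ proj₂ (rowBPD R₀ (proj₁ (rowBPD R₁ s 0)) 0) ⊎
  proj₂ (rowCo (map checkTile R₀) a 0) ≤
    proj₂ (rowCo (map checkTile R₁) (proj₁ (rowCo (map checkTile R₀) a 0)) 0)
adjacentRows-exit-dichotomy R₀ R₁ s a c₀ c₁ v with lastElbowInUpper false R₀ R₁ in last
... | true  = inj₁ (rowBPD-exit-ordered R₀ R₁ s false c₀ c₁ v (λ ()) last)
... | false = inj₂ (rowCo-exit-ordered R₀ R₁ a false c₀ c₁ v (λ ()) last)

PositiveAbove : ∀ {m} → Vec Tile m → Vec ℕ m → Set
PositiveAbove = Pointwise (λ t a → T (not (tN t)) → 0 < a)

PositiveBelow : ∀ {m} → Vec Tile m → Vec ℕ m → Set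
PositiveBelow = Pointwise (λ t a → T (not (tS t)) → 0 < a)

stepCo-positive : ∀ t a w → (T (tW t) → 0 < w) → (T (not (tN t)) → 0 < a) →
  (T (not (tS t)) → 0 < proj₁ (stepCo (checkTile t) a w)) ×
  (T (tE t) → 0 < proj₂ (stepCo (checkTile t) a w))
stepCo-positive elbowSE a w pw pa = (λ ()) , (λ _ → pa tt)
stepCo-positive elbowNW a w pw pa = (λ _ → pw tt) , (λ ())
stepCo-positive horiz   a w pw pa = (λ _ → ≤-trans (pa tt) (m≤m⊔n a w)) , (λ _ → ⊓-glb (pa tt) (pw tt))
stepCo-positive vert    a w pw pa = (λ ()) , (λ ())
stepCo-positive cross   a w pw pa = (λ ()) , (λ _ → pw tt)
stepCo-positive blank   a w pw pa = (λ _ → pa tt) , (λ ())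

rowCo-positive : ∀ {m h w} (R : Vec Tile m) (a : Vec ℕ m) →
  ConnectedRow h R → (T h → 0 < w) → PositiveAbove R a →
  PositiveBelow R (proj₁ (rowCo (map checkTile R) a w)) × 0 < proj₂ (rowCo (map checkTile R) a w)
rowCo-positive []      []      refl pw []         = [] , pw tt
rowCo-positive {w = w} (t ∷ R) (a ∷ as) (refl , c) pw (pa ∷ pas) =
  let (pd , pr)  = stepCo-positive t a w pw pa
      (pds , pe) = rowCo-positive R as c pr pas
  in (pd ∷ pds) , pe

positiveBelow⇒positiveAbove : ∀ {m} {R₀ R₁ : Vec Tile m} {d : Vec ℕ m} →
  VerticallyMatched R₀ R₁ → PositiveBelow R₀ d → PositiveAbove R₁ d
positiveBelow⇒positiveAbove []       []       = []
positiveBelow⇒positiveAbove (v ∷ vs) (p ∷ ps) =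
  (λ noPipe → p (subst (T ∘ not) (sym v) noPipe)) ∷ positiveBelow⇒positiveAbove vs ps

labels-positiveAbove : ∀ {n} (R : Vec Tile n) → PositiveAbove R (labels n)
labels-positiveAbove {n} R =
  Pointwise.map (λ p _ → p) (All⇒Pointwiseʳ (map⁺ (All.universal (λ _ → z<s) (allFin n))))

indicator : ℕ → ℕ → ℕ
indicator x y = if does (x ≟ y) then 1 else 0

occurrences : ∀ {m} → ℕ → Vec ℕ m → ℕ
occurrences x v = sum (map (indicator x) v)

indicator-refl : ∀ x → indicator x x ≡ 1
indicator-refl x = cong (if_then 1 else 0) (dec-true (x ≟ x) refl)

indicator-≢ : ∀ x y → x ≢ y → indicator x y ≡ 0
indicator-≢ x y x≢y = cong (if_then 1 else 0) (dec-false (x ≟ y) x≢y)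

stepCo-conserves : ∀ x t a w →
  indicator (suc x) (proj₁ (stepCo t a w)) + indicator (suc x) (proj₂ (stepCo t a w)) ≤
    indicator (suc x) w + indicator (suc x) a
stepCo-conserves x celbowNE a w = m≤n+m _ _
stepCo-conserves x celbowSW a w = +-monoʳ-≤ _ z≤n
stepCo-conserves x ccross   a w with ≤-total a w
... | inj₁ a≤w rewrite m≤n⇒m⊔n≡n a≤w | m≤n⇒m⊓n≡m a≤w = ≤-refl
... | inj₂ w≤a rewrite m≥n⇒m⊔n≡m w≤a | m≥n⇒m⊓n≡n w≤a =
  ≤-reflexive (+-comm (indicator (suc x) a) (indicator (suc x) w))
stepCo-conserves x cblank   a w = z≤n
stepCo-conserves x choriz   a w = m≤m+n _ _
stepCo-conserves x cvert    a w = ≤-trans (≤-reflexive (+-identityʳ _)) (m≤n+m _ _)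

rowCo-conserves : ∀ {m} x (R : Vec CoTile m) a w →
  occurrences (suc x) (proj₂ (rowCo R a w) ∷ proj₁ (rowCo R a w)) ≤ occurrences (suc x) (w ∷ a)
rowCo-conserves x []      []       w = ≤-refl
rowCo-conserves x (t ∷ R) (a ∷ as) w = begin
  I out + (I down + O downs)  ≡⟨ x∙yz≈y∙xz (I out) (I down) (O downs) ⟩
  I down + (I out + O downs)  ≤⟨ +-monoʳ-≤ (I down) (rowCo-conserves x R as right) ⟩
  I down + (I right + O as)   ≡⟨ +-assoc (I down) (I right) (O as) ⟨
  (I down + I right) + O as   ≤⟨ +-monoˡ-≤ (O as) (stepCo-conserves x t a w) ⟩
  (I w + I a) + O as          ≡⟨ +-assoc (I w) (I a) (O as) ⟩
  I w + (I a + O as)          ∎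
  where
  open ≤-Reasoning
  I = indicator (suc x)
  O : ∀ {k} → Vec ℕ k → ℕ
  O = occurrences (suc x)
  down  = proj₁ (stepCo t a w)
  right = proj₂ (stepCo t a w)
  downs = proj₁ (rowCo R as right)
  out   = proj₂ (rowCo R as right)

rowsCo-conserves : ∀ {n m} x (Rs : Vec (Vec CoTile n) m) a →
  occurrences (suc x) (rowsCo Rs a) ≤ occurrences (suc x) a
rowsCo-conserves x []       a = z≤n
rowsCo-conserves x (R ∷ Rs) a =
  ≤-trans (+-monoʳ-≤ (indicator (suc x) (proj₂ (rowCo R a 0)))
                     (rowsCo-conserves x Rs (proj₁ (rowCo R a 0))))
          (rowCo-conserves x R a 0)

occurrences-absent : ∀ {m x} {v : Vec ℕ m} → All (x ≢_) v → occurrences x v ≡ 0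
occurrences-absent []            = refl
occurrences-absent {x = x} {y ∷ _} (x≢y ∷ x∉v) rewrite indicator-≢ x y x≢y = occurrences-absent x∉v

unique⇒occurrences≤1 : ∀ {m} x {v : Vec ℕ m} → Unique v → occurrences x v ≤ 1
unique⇒occurrences≤1 x []                 = z≤n
unique⇒occurrences≤1 x {y ∷ v} (y∉v ∷ uniq) with x ≟ y
... | yes refl rewrite indicator-refl x | occurrences-absent y∉v = ≤-refl
... | no x≢y   rewrite indicator-≢ x y x≢y = unique⇒occurrences≤1 x uniq

labels-unique : ∀ n → Unique (labels n)
labels-unique n = Unique.map⁺ (λ eq → toℕ-injective (suc-injective eq)) (tabulate⁺ (λ eq → eq))

record PositivesDistinct {m} (v : Vec ℕ m) : Set where
  constructor positivesDistinct
  field occurrences≤1 : ∀ x → occurrences (suc x) v ≤ 1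

positivesDistinct-tail : ∀ {m a} {v : Vec ℕ m} → PositivesDistinct (a ∷ v) → PositivesDistinct v
positivesDistinct-tail (positivesDistinct distinct) =
  positivesDistinct (λ x → ≤-trans (m≤n+m _ _) (distinct x))

positivesDistinct-head : ∀ {m a b} {v : Vec ℕ m} → 0 < a → PositivesDistinct (a ∷ b ∷ v) → a ≢ b
positivesDistinct-head {a = suc y} {v = v} _ (positivesDistinct distinct) refl
  with subst (λ i → i + (i + occurrences (suc y) v) ≤ 1) (indicator-refl (suc y)) (distinct y)
... | s≤s ()

ascent-transfer : ∀ {n m} (R : Vec Tile n) (Rs : Vec (Vec Tile n) m) (b a : Vec ℕ n) k →
  WellFormedRows (R ∷ Rs) → PositiveAbove R a →
  PositivesDistinct (rowsCo (map (map checkTile) (R ∷ Rs)) a) →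
  AscentAt (toList (proj₂ (rowsBPD (R ∷ Rs) b))) k →
  AscentAt (toList (rowsCo (map (map checkTile) (R ∷ Rs)) a)) k
ascent-transfer R₀ [] b a zero    _ _ _ ()
ascent-transfer R₀ [] b a (suc k) _ _ _ ()
ascent-transfer R₀ (R₁ ∷ Rs) b a zero (c₀ , v , wf) pos distinct asc
  with adjacentRows-exit-dichotomy R₀ R₁ (proj₁ (rowsBPD Rs b)) a c₀ (wellFormedRows-head Rs wf) v
... | inj₁ bpd-descent = contradiction asc (≤⇒≯ bpd-descent)
... | inj₂ co-weak-ascent =
  ≤∧≢⇒< co-weak-ascent (positivesDistinct-head (proj₂ (rowCo-positive R₀ a c₀ (λ ()) pos)) distinct)
ascent-transfer R₀ (R₁ ∷ Rs) b a (suc k) (c₀ , v , wf) pos distinct asc =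
  ascent-transfer R₁ Rs b (proj₁ (rowCo (map checkTile R₀) a 0)) k wf
    (positiveBelow⇒positiveAbove v (proj₁ (rowCo-positive R₀ a c₀ (λ ()) pos)))
    (positivesDistinct-tail distinct) asc

lemma4p11 : (n : ℕ) → 1 ≤ n → (B : Grid Tile n) → IsBPD B →
    (k : ℕ) → suc k < n →
    HasAscent (δ B) k → HasAscent (δco (check B)) k
lemma4p11 (suc n) _ (R ∷ Rs) bpd k _ =
  ascent-transfer R Rs (labels (suc n)) (labels (suc n)) k
    (isBPD⇒wellFormedRows bpd) (labels-positiveAbove R) labels-leave-once
  where
  labels-leave-once : PositivesDistinct (δco (check (R ∷ Rs)))
  labels-leave-once = positivesDistinct λ x →
    ≤-trans (rowsCo-conserves x (check (R ∷ Rs)) (labels (suc n)))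
            (unique⇒occurrences≤1 (suc x) (labels-unique (suc n)))
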